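{- Let $\mathsf{M}=(E,\mathcal{L})$ be a loopless matroid with Chow ring $A^*(\mathsf{M})$. For any proper flat $F\in\mathcal{L}^*$, we have \[ D_F^2=D_F\,(-\psi_F^--\psi_F^+)\in A^2(\mathsf{M}). \]
   Context: A matroid $\mathsf{M}=(E,\mathcal{L})$ is given by a finite ground set $E$ and its lattice of flats $\mathcal{L}\subseteq 2^E$; it is loopless if $\emptyset\in\mathcal{L}$. Write $\mathcal{L}^*=\mathcal{L}\setminus\{\emptyset,E\}$ for the proper flats. The Chow ring is $A^*(\mathsf{M})=\mathbb{Z}[X_F\mid F\in\mathcal{L}^*]/(\mathcal{I}+\mathcal{J})$, where $\mathcal{I}$ is generated by $X_{F_1}X_{F_2}$ for incomparable $F_1,F_2$, and $\mathcal{J}$ is generated by $\sum_{F\in\mathcal{L}^*,\,e\in F}X_F-\sum_{F\in\mathcal{L}^*,\,f\in F}X_F$ for $e,f\in E$. Write $D_F\in A^1(\mathsf{M})$ for the class of $X_F$. For any flat $F\in\mathcal{L}$ and any $e\in E$ (the result is independent of $e$), the psi classes are \[ \psi_F^-=\sum_{G\in\mathcal{L}^*,\,e\in G}D_G-\sum_{G\in\mathcal{L}^*,\,G\supseteq F}D_G,\qquad \psi_F^+=\sum_{G\in\mathcal{L}^*,\,e\notin G}D_G-\sum_{G\in\mathcal{L}^*,\,G\subseteq F}D_G. \] -}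

module Defs where

open import Level using (0ℓ)
open import Data.Nat using (ℕ; zero; suc)
open import Data.Bool using (Bool; true; false; _∧_; not)
open import Data.Fin using (Fin)
open import Data.Fin.Subset using (Subset; _∈_; _∉_; _⊆_; _⊂_; _∩_; ⊤; ⊥)
open import Data.Fin.Subset.Properties using (_∈?_; _⊆?_)
open import Data.Vec using (Vec; []; _∷_)
open import Data.Vec.Properties using (≡-dec)
open import Data.List using (List; []; _∷_; _++_; map; filter)
open import Data.Product using (Σ; _×_; _,_)
open import Relation.Nullary using (¬_; Dec; yes; no)
open import Relation.Nullary.Decidable using (⌊_⌋)
open import Relation.Binary.PropositionalEquality using (_≡_; _≢_)
open import Algebra.Bundles using (CommutativeRing)
import Data.Bool as B

allSubsets : (n : ℕ) → List (Subset n)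
allSubsets zero = [] ∷ []
allSubsets (suc n) =
  map (Data.Fin.Subset.outside ∷_) (allSubsets n) ++ map (Data.Fin.Subset.inside ∷_) (allSubsets n)

_≟ˢ_ : {n : ℕ} → (S T : Subset n) → Dec (S ≡ T)
_≟ˢ_ = ≡-dec B._≟_

-- A matroid on E = Fin n, given by its (decidable) set of flats, satisfying
-- the flat axioms: E is a flat, flats are closed under intersection, and for
-- every flat F the flats covering F partition E ∖ F.
module _ {n : ℕ} (isFlat : Subset n → Bool) where

  Flat : Subset n → Set
  Flat F = isFlat F ≡ true

  Covers : Subset n → Subset n → Set
  Covers F G = Flat G × F ⊂ G × ((H : Subset n) → Flat H → F ⊂ H → ¬ (H ⊂ G))

record Matroid (n : ℕ) : Set where
  field
    isFlat     : Subset n → Bool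
    top-flat   : Flat isFlat ⊤
    inter-flat : (F G : Subset n) → Flat isFlat F → Flat isFlat G → Flat isFlat (F ∩ G)
    partition  : (F : Subset n) → Flat isFlat F → (e : Fin n) → e ∉ F →
                 Σ (Subset n) (λ G → (Covers isFlat F G × e ∈ G) ×
                   ((G' : Subset n) → Covers isFlat F G' → e ∈ G' → G' ≡ G))

open Matroid public

Loopless : {n : ℕ} → Matroid n → Set
Loopless M = Flat (isFlat M) ⊥

ProperFlat : {n : ℕ} → Matroid n → Subset n → Set
ProperFlat M F = Flat (isFlat M) F × F ≢ ⊥ × F ≢ ⊤

isProper : {n : ℕ} → Matroid n → Subset n → Bool
isProper M F = isFlat M F ∧ not ⌊ F ≟ˢ ⊥ ⌋ ∧ not ⌊ F ≟ˢ ⊤ ⌋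

-- Chow ring presentation, via its universal property: an assignment of
-- elements X_F of a commutative ring to proper flats F satisfying the
-- relations I and J is the same as a ring map A*(M) → R.
module ChowRing {n : ℕ} (M : Matroid n) (R : CommutativeRing 0ℓ 0ℓ) where
  open CommutativeRing R

  sumProper : (Subset n → Bool) → (Subset n → Carrier) → Carrier
  sumProper P X = go (allSubsets n)
    where
      go : List (Subset n) → Carrier
      go [] = 0#
      go (G ∷ Gs) with isProper M G ∧ P G
      ... | true  = X G + go Gs
      ... | false = go Gs

  SatisfiesRelations : (Subset n → Carrier) → Set
  SatisfiesRelations X =
    ((F₁ F₂ : Subset n) → ProperFlat M F₁ → ProperFlat M F₂ →
       ¬ (F₁ ⊆ F₂) → ¬ (F₂ ⊆ F₁) → X F₁ * X F₂ ≈ 0#)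
    × ((e f : Fin n) →
       sumProper (λ G → ⌊ e ∈? G ⌋) X ≈ sumProper (λ G → ⌊ f ∈? G ⌋) X)

  ψ⁻ : (Subset n → Carrier) → Fin n → Subset n → Carrier
  ψ⁻ X e F = sumProper (λ G → ⌊ e ∈? G ⌋) X - sumProper (λ G → ⌊ F ⊆? G ⌋) X

  ψ⁺ : (Subset n → Carrier) → Fin n → Subset n → Carrier
  ψ⁺ X e F = sumProper (λ G → not ⌊ e ∈? G ⌋) X - sumProper (λ G → ⌊ G ⊆? F ⌋) X

{-# OPTIONS --safe #-}
-- Since e ∈ G or e ∉ G for every proper flat G, the two e-sums in ψ⁻ and ψ⁺ add up to the
-- sum of all D_G, so −ψ⁻ − ψ⁺ = Σ_{G ⊇ F} D_G + Σ_{G ⊆ F} D_G − Σ_G D_G. By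
-- inclusion–exclusion the first two sums are the sum over flats comparable with F plus
-- D_F, the only flat that is both. After multiplying by D_F, the incomparable flats drop out
-- by the monomial relations, which leaves D_F · D_F.
module Submission where

open import Defs
open import Level using (Level; 0ℓ)
open import Data.Nat using (ℕ; zero; suc)
open import Data.Fin using (Fin)
open import Data.Fin.Subset using (Subset; _⊆_; inside; outside; ⊥; ⊤)
open import Data.Fin.Subset.Properties using (_∈?_; _⊆?_; ⊆-refl; ⊆-antisym)
open import Data.Bool using (Bool; true; false; T; _∧_; _∨_; not; if_then_else_)
open import Data.Bool.Properties using (∨-inverseʳ; ∧-inverseʳ)
open import Data.List using (List; []; _∷_; _++_; map)
open import Data.Vec using ([]; _∷_)
open import Data.Vec.Properties using (∷-injectiveˡ; ∷-injectiveʳ)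
open import Data.Product using (Σ; _×_; _,_; proj₁; proj₂)
open import Function using (_∘_)
open import Relation.Nullary using (¬_; yes; no)
open import Relation.Nullary.Decidable using (⌊_⌋)
open import Relation.Binary.PropositionalEquality as ≡ using (_≡_)
open import Algebra.Bundles using (CommutativeMonoid; AbelianGroup; Semiring; CommutativeRing)
import Algebra.Properties.CommutativeSemigroup as CommutativeSemigroupProperties
import Relation.Binary.Reasoning.Setoid as SetoidReasoning
import Algebra.Properties.AbelianGroup as AbelianGroupProperties
import Algebra.Properties.Ring as RingProperties

private
  variable
    a : Level
    A B : Set a

module FilteredSum {c ℓ} (M : CommutativeMonoid c ℓ) where
  open CommutativeMonoid M
  open CommutativeSemigroupProperties commutativeSemigroup using (interchange; x∙yz≈y∙xz)
  open SetoidReasoning setoid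

  sumWhere : (A → Carrier) → (A → Bool) → List A → Carrier
  sumWhere f P []       = ε
  sumWhere f P (x ∷ xs) = if P x then f x ∙ sumWhere f P xs else sumWhere f P xs

  module _ {f : A → Carrier} where

    sumWhere-cong : {P Q : A → Bool} → (∀ x → P x ≡ Q x) →
                    ∀ L → sumWhere f P L ≡ sumWhere f Q L
    sumWhere-cong P≗Q []       = ≡.refl
    sumWhere-cong P≗Q (x ∷ xs) =
      ≡.cong₂ (λ p s → if p then f x ∙ s else s) (P≗Q x) (sumWhere-cong P≗Q xs)

    sumWhere-map : {P : A → Bool} (g : B → A) →
                   ∀ L → sumWhere f P (map g L) ≡ sumWhere (f ∘ g) (P ∘ g) L
    sumWhere-map         g []       = ≡.refl
    sumWhere-map {P = P} g (x ∷ xs) =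
      ≡.cong (λ s → if P (g x) then f (g x) ∙ s else s) (sumWhere-map g xs)

    sumWhere-++ : {P : A → Bool} →
                  ∀ L₁ L₂ → sumWhere f P (L₁ ++ L₂) ≈ sumWhere f P L₁ ∙ sumWhere f P L₂
    sumWhere-++         []       L₂ = sym (identityˡ _)
    sumWhere-++ {P = P} (x ∷ xs) L₂ with P x
    ... | true  = trans (∙-congˡ (sumWhere-++ xs L₂)) (sym (assoc _ _ _))
    ... | false = sumWhere-++ xs L₂

    sumWhere-≈ε : {P : A → Bool} → (∀ x → T (P x) → f x ≈ ε) →
                  ∀ L → sumWhere f P L ≈ ε
    sumWhere-≈ε         f≈ε []       = refl
    sumWhere-≈ε {P = P} f≈ε (x ∷ xs) with P x | f≈ε x
    ... | true  | fx≈ε = trans (∙-cong (fx≈ε _) (sumWhere-≈ε f≈ε xs)) (identityˡ ε)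
    ... | false | _    = sumWhere-≈ε f≈ε xs

    sumWhere-∨-∧ : {P Q : A → Bool} → ∀ L →
                   sumWhere f P L ∙ sumWhere f Q L ≈
                   sumWhere f (λ x → P x ∨ Q x) L ∙ sumWhere f (λ x → P x ∧ Q x) L
    sumWhere-∨-∧                 []       = refl
    sumWhere-∨-∧ {P = P} {Q = Q} (x ∷ xs) with P x | Q x | sumWhere-∨-∧ {P = P} {Q = Q} xs
    ... | true  | true  | ih = trans (interchange _ _ _ _)
                                 (trans (∙-congˡ ih) (interchange _ _ _ _))
    ... | true  | false | ih = trans (assoc _ _ _) (trans (∙-congˡ ih) (sym (assoc _ _ _)))
    ... | false | true  | ih = trans (x∙yz≈y∙xz _ _ _)
                                 (trans (∙-congˡ ih) (sym (assoc _ _ _)))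
    ... | false | false | ih = ih

    sumWhere-complement : {P : A → Bool} → ∀ L →
                          sumWhere f P L ∙ sumWhere f (not ∘ P) L ≈ sumWhere f (λ _ → true) L
    sumWhere-complement {P = P} L = begin
      sumWhere f P L ∙ sumWhere f (not ∘ P) L
        ≈⟨ sumWhere-∨-∧ L ⟩
      sumWhere f (λ x → P x ∨ not (P x)) L ∙ sumWhere f (λ x → P x ∧ not (P x)) L
        ≡⟨ ≡.cong₂ _∙_ (sumWhere-cong (∨-inverseʳ ∘ P) L) (sumWhere-cong (∧-inverseʳ ∘ P) L) ⟩
      sumWhere f (λ _ → true) L ∙ sumWhere f (λ _ → false) L
        ≈⟨ ∙-congˡ (sumWhere-≈ε (λ _ ()) L) ⟩
      sumWhere f (λ _ → true) L ∙ ε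
        ≈⟨ identityʳ _ ⟩
      sumWhere f (λ _ → true) L ∎

  sumWhere-allSubsets-suc : ∀ {n} (f : Subset (suc n) → Carrier) (P : Subset (suc n) → Bool) →
    sumWhere f P (allSubsets (suc n)) ≈
    sumWhere (f ∘ (outside ∷_)) (P ∘ (outside ∷_)) (allSubsets n) ∙
    sumWhere (f ∘ (inside ∷_)) (P ∘ (inside ∷_)) (allSubsets n)
  sumWhere-allSubsets-suc {n} f P = begin
    sumWhere f P (allSubsets (suc n))
      ≈⟨ sumWhere-++ (map (outside ∷_) (allSubsets n)) _ ⟩
    sumWhere f P (map (outside ∷_) (allSubsets n)) ∙ sumWhere f P (map (inside ∷_) (allSubsets n))
      ≡⟨ ≡.cong₂ _∙_ (sumWhere-map _ (allSubsets n)) (sumWhere-map _ (allSubsets n)) ⟩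
    sumWhere (f ∘ (outside ∷_)) (P ∘ (outside ∷_)) (allSubsets n) ∙
    sumWhere (f ∘ (inside ∷_)) (P ∘ (inside ∷_)) (allSubsets n) ∎

  sumWhere-allSubsets-unique : ∀ {n} (f : Subset n → Carrier) {P : Subset n → Bool} {F : Subset n} →
    T (P F) → (∀ G → T (P G) → G ≡ F) → sumWhere f P (allSubsets n) ≈ f F
  sumWhere-allSubsets-unique {zero} f {P} {[]} PF _ with P [] | PF
  ... | true | _ = identityʳ (f [])
  sumWhere-allSubsets-unique {suc n} f {P} {outside ∷ F} PF unique = begin
    sumWhere f P (allSubsets (suc n))
      ≈⟨ sumWhere-allSubsets-suc f P ⟩
    sumWhere (f ∘ (outside ∷_)) (P ∘ (outside ∷_)) (allSubsets n) ∙
    sumWhere (f ∘ (inside ∷_)) (P ∘ (inside ∷_)) (allSubsets n)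
      ≈⟨ ∙-cong (sumWhere-allSubsets-unique _ PF (λ G → ∷-injectiveʳ ∘ unique _))
                (sumWhere-≈ε (λ G → (λ ()) ∘ ∷-injectiveˡ ∘ unique (inside ∷ G)) (allSubsets n)) ⟩
    f (outside ∷ F) ∙ ε
      ≈⟨ identityʳ _ ⟩
    f (outside ∷ F) ∎
  sumWhere-allSubsets-unique {suc n} f {P} {inside ∷ F} PF unique = begin
    sumWhere f P (allSubsets (suc n))
      ≈⟨ sumWhere-allSubsets-suc f P ⟩
    sumWhere (f ∘ (outside ∷_)) (P ∘ (outside ∷_)) (allSubsets n) ∙
    sumWhere (f ∘ (inside ∷_)) (P ∘ (inside ∷_)) (allSubsets n)
      ≈⟨ ∙-cong (sumWhere-≈ε (λ G → (λ ()) ∘ ∷-injectiveˡ ∘ unique (outside ∷ G)) (allSubsets n))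
                (sumWhere-allSubsets-unique _ PF (λ G → ∷-injectiveʳ ∘ unique _)) ⟩
    ε ∙ f (inside ∷ F)
      ≈⟨ identityˡ _ ⟩
    f (inside ∷ F) ∎

module _ {c ℓ} (S : Semiring c ℓ) where
  open Semiring S
  open FilteredSum +-commutativeMonoid

  *-distribˡ-sumWhere : ∀ x (f : A → Carrier) P L →
                        x * sumWhere f P L ≈ sumWhere (λ y → x * f y) P L
  *-distribˡ-sumWhere x f P []       = zeroʳ x
  *-distribˡ-sumWhere x f P (y ∷ ys) with P y
  ... | true  = trans (distribˡ x (f y) _) (+-congˡ (*-distribˡ-sumWhere x f P ys))
  ... | false = *-distribˡ-sumWhere x f P ys

module _ {c ℓ} (G : AbelianGroup c ℓ) where
  open AbelianGroup G
  open AbelianGroupProperties G using (⁻¹-anti-homo‿-; ⁻¹-∙-comm)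
  open CommutativeSemigroupProperties commutativeSemigroup using (interchange)
  open SetoidReasoning setoid

  [a-c]⁻¹-[b-d]≈[c∙d]-[a∙b] : ∀ a b c d → (a - c) ⁻¹ - (b - d) ≈ (c ∙ d) - (a ∙ b)
  [a-c]⁻¹-[b-d]≈[c∙d]-[a∙b] a b c d = begin
    (a - c) ⁻¹ ∙ (b - d) ⁻¹  ≈⟨ ∙-cong (⁻¹-anti-homo‿- a c) (⁻¹-anti-homo‿- b d) ⟩
    (c - a) ∙ (d - b)        ≈⟨ interchange c (a ⁻¹) d (b ⁻¹) ⟩
    (c ∙ d) ∙ (a ⁻¹ ∙ b ⁻¹)  ≈⟨ ∙-congˡ (⁻¹-∙-comm a b) ⟩
    (c ∙ d) - (a ∙ b)        ∎

comparable : ∀ {n} → Subset n → Subset n → Bool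
comparable F G = ⌊ F ⊆? G ⌋ ∨ ⌊ G ⊆? F ⌋

T-not-comparable : ∀ {n} (F G : Subset n) → T (not (comparable F G)) → ¬ F ⊆ G × ¬ G ⊆ F
T-not-comparable F G with F ⊆? G | G ⊆? F
... | no F⊈G | no G⊈F = λ _ → F⊈G , G⊈F
... | yes _  | _      = λ ()
... | no _   | yes _  = λ ()

T-⊆?-∧-⊇?⇒≡ : ∀ {n} (F G : Subset n) → T (⌊ F ⊆? G ⌋ ∧ ⌊ G ⊆? F ⌋) → G ≡ F
T-⊆?-∧-⊇?⇒≡ F G with F ⊆? G | G ⊆? F
... | yes F⊆G | yes G⊆F = λ _ → ⊆-antisym G⊆F F⊆G
... | yes _   | no _    = λ ()
... | no _    | _       = λ ()

T-⊆?-∧-⊇?-refl : ∀ {n} (F : Subset n) → T (⌊ F ⊆? F ⌋ ∧ ⌊ F ⊆? F ⌋)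
T-⊆?-∧-⊇?-refl F with F ⊆? F
... | yes _   = _
... | no F⊈F = F⊈F ⊆-refl

module _ {n : ℕ} (M : Matroid n) where

  isProper⇒ProperFlat : ∀ G → T (isProper M G) → ProperFlat M G
  isProper⇒ProperFlat G with isFlat M G | G ≟ˢ ⊥ | G ≟ˢ ⊤
  ... | true | no G≢⊥ | no G≢⊤ = λ _ → ≡.refl , G≢⊥ , G≢⊤
  ... | true | no _   | yes _  = λ ()
  ... | true | yes _  | _      = λ ()

  ProperFlat⇒isProper : ∀ F → ProperFlat M F → T (isProper M F)
  ProperFlat⇒isProper F (F-flat , F≢⊥ , F≢⊤) rewrite F-flat with F ≟ˢ ⊥ | F ≟ˢ ⊤
  ... | no _    | no _    = _
  ... | yes F≡⊥ | _       = F≢⊥ F≡⊥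
  ... | no _    | yes F≡⊤ = F≢⊤ F≡⊤

module _ {n : ℕ} (M : Matroid n) (R : CommutativeRing 0ℓ 0ℓ) (X : Subset n → CommutativeRing.Carrier R) where
  open CommutativeRing R
  open ChowRing M R
  open FilteredSum +-commutativeMonoid
  open SetoidReasoning setoid

  X-on-proper : Subset n → Carrier
  X-on-proper G = if isProper M G then X G else 0#

  sumX : (Subset n → Bool) → Carrier
  sumX P = sumWhere X-on-proper P (allSubsets n)

  X-on-proper-proper : ∀ F → ProperFlat M F → X-on-proper F ≡ X F
  X-on-proper-proper F F-proper with isProper M F | ProperFlat⇒isProper M F F-proper
  ... | true | _ = ≡.refl

  -- `sumProper` recurses through an anonymous `where`-bound function; abstracting
  -- `allSubsets n` makes unification hand that function back to us as `go`.
  private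
    sumProper-unfolding : (P : Subset n → Bool) →
      Σ (List (Subset n) → Carrier) λ go → go (allSubsets n) ≡ sumProper P X
    sumProper-unfolding P = go , go-allSubsets
      where
      go : List (Subset n) → Carrier
      go = _
      go-allSubsets : go (allSubsets n) ≡ sumProper P X
      go-allSubsets with allSubsets n
      ... | _ = ≡.refl

  sumProper≈sumX : ∀ P → sumProper P X ≈ sumX P
  sumProper≈sumX P = begin
    sumProper P X      ≡⟨ ≡.sym (proj₂ (sumProper-unfolding P)) ⟩
    go (allSubsets n)  ≈⟨ go≈sumWhere (allSubsets n) ⟩
    sumX P             ∎
    where
    go : List (Subset n) → Carrier
    go = proj₁ (sumProper-unfolding P)
    go≈sumWhere : ∀ L → go L ≈ sumWhere X-on-proper P L
    go≈sumWhere []       = refl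
    go≈sumWhere (G ∷ Gs) with isProper M G | P G
    ... | true  | true  = +-congˡ (go≈sumWhere Gs)
    ... | true  | false = go≈sumWhere Gs
    ... | false | true  = trans (go≈sumWhere Gs) (sym (+-identityˡ _))
    ... | false | false = go≈sumWhere Gs

  sumProper-complement : ∀ P → sumProper P X + sumProper (not ∘ P) X ≈ sumProper (λ _ → true) X
  sumProper-complement P = begin
    sumProper P X + sumProper (not ∘ P) X
      ≈⟨ +-cong (sumProper≈sumX P) (sumProper≈sumX (not ∘ P)) ⟩
    sumX P + sumX (not ∘ P)
      ≈⟨ sumWhere-complement (allSubsets n) ⟩
    sumX (λ _ → true)
      ≈⟨ sym (sumProper≈sumX (λ _ → true)) ⟩
    sumProper (λ _ → true) X ∎

  module _ (relations : SatisfiesRelations X) {F : Subset n} (F-proper : ProperFlat M F) where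

    *-sumX-comparable : X F * sumX (comparable F) ≈ X F * sumX (λ _ → true)
    *-sumX-comparable = begin
      X F * sumX (comparable F)
        ≈⟨ sym (+-identityʳ _) ⟩
      X F * sumX (comparable F) + 0#
        ≈⟨ +-congˡ (sym incomparable-part-vanishes) ⟩
      X F * sumX (comparable F) + X F * sumX (not ∘ comparable F)
        ≈⟨ sym (distribˡ (X F) _ _) ⟩
      X F * (sumX (comparable F) + sumX (not ∘ comparable F))
        ≈⟨ *-congˡ (sumWhere-complement (allSubsets n)) ⟩
      X F * sumX (λ _ → true) ∎
      where
      incomparable-vanishes : ∀ G → T (not (comparable F G)) → X F * X-on-proper G ≈ 0#
      incomparable-vanishes G G≶F with isProper M G | isProper⇒ProperFlat M G
      ... | true  | G-proper = let F⊈G , G⊈F = T-not-comparable F G G≶F in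
                               proj₁ relations F G F-proper (G-proper _) F⊈G G⊈F
      ... | false | _        = zeroʳ (X F)

      incomparable-part-vanishes : X F * sumX (not ∘ comparable F) ≈ 0#
      incomparable-part-vanishes =
        trans (*-distribˡ-sumWhere semiring (X F) X-on-proper _ (allSubsets n))
              (sumWhere-≈ε incomparable-vanishes (allSubsets n))

    sumX-⊆?-∧-⊇? : sumX (λ G → ⌊ F ⊆? G ⌋ ∧ ⌊ G ⊆? F ⌋) ≈ X F
    sumX-⊆?-∧-⊇? = begin
      sumX (λ G → ⌊ F ⊆? G ⌋ ∧ ⌊ G ⊆? F ⌋)
        ≈⟨ sumWhere-allSubsets-unique X-on-proper (T-⊆?-∧-⊇?-refl F) (T-⊆?-∧-⊇?⇒≡ F) ⟩
      X-on-proper F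
        ≡⟨ X-on-proper-proper F F-proper ⟩
      X F ∎

    *-sumProper-⊇+⊆ : X F * (sumProper (λ G → ⌊ F ⊆? G ⌋) X + sumProper (λ G → ⌊ G ⊆? F ⌋) X) ≈
                      X F * (sumProper (λ _ → true) X + X F)
    *-sumProper-⊇+⊆ = begin
      X F * (sumProper (λ G → ⌊ F ⊆? G ⌋) X + sumProper (λ G → ⌊ G ⊆? F ⌋) X)
        ≈⟨ *-congˡ (+-cong (sumProper≈sumX _) (sumProper≈sumX _)) ⟩
      X F * (sumX (λ G → ⌊ F ⊆? G ⌋) + sumX (λ G → ⌊ G ⊆? F ⌋))
        ≈⟨ *-congˡ (sumWhere-∨-∧ (allSubsets n)) ⟩
      X F * (sumX (comparable F) + sumX (λ G → ⌊ F ⊆? G ⌋ ∧ ⌊ G ⊆? F ⌋))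
        ≈⟨ distribˡ (X F) _ _ ⟩
      X F * sumX (comparable F) + X F * sumX (λ G → ⌊ F ⊆? G ⌋ ∧ ⌊ G ⊆? F ⌋)
        ≈⟨ +-cong *-sumX-comparable (*-congˡ sumX-⊆?-∧-⊇?) ⟩
      X F * sumX (λ _ → true) + X F * X F
        ≈⟨ sym (distribˡ (X F) _ _) ⟩
      X F * (sumX (λ _ → true) + X F)
        ≈⟨ *-congˡ (+-congʳ (sym (sumProper≈sumX _))) ⟩
      X F * (sumProper (λ _ → true) X + X F) ∎

proposition3p3 : (n : ℕ) (M : Matroid n) → Loopless M →
    (R : CommutativeRing 0ℓ 0ℓ) (X : Subset n → CommutativeRing.Carrier R) →
    ChowRing.SatisfiesRelations M R X →
    (F : Subset n) → ProperFlat M F → (e : Fin n) →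
    CommutativeRing._≈_ R
      (CommutativeRing._*_ R (X F) (X F))
      (CommutativeRing._*_ R (X F)
        (CommutativeRing._-_ R (CommutativeRing.-_ R (ChowRing.ψ⁻ M R X e F)) (ChowRing.ψ⁺ M R X e F)))
proposition3p3 n M _ R X relations F F-proper e = sym (begin
  X F * ((- (e∈ - ⊇F)) - (e∉ - ⊆F))
    ≈⟨ *-congˡ ([a-c]⁻¹-[b-d]≈[c∙d]-[a∙b] +-abelianGroup e∈ e∉ ⊇F ⊆F) ⟩
  X F * ((⊇F + ⊆F) - (e∈ + e∉))
    ≈⟨ x[y-z]≈xy-xz (X F) _ _ ⟩
  X F * (⊇F + ⊆F) - X F * (e∈ + e∉)
    ≈⟨ +-cong (*-sumProper-⊇+⊆ M R X relations F-proper)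
              (-‿cong (*-congˡ (sumProper-complement M R X (λ G → ⌊ e ∈? G ⌋)))) ⟩
  X F * (all + X F) - X F * all
    ≈⟨ +-congʳ (distribˡ (X F) all (X F)) ⟩
  (X F * all + X F * X F) - X F * all
    ≈⟨ xyx⁻¹≈y (X F * all) (X F * X F) ⟩
  X F * X F ∎)
  where
  open CommutativeRing R
  open ChowRing M R
  open RingProperties ring using (x[y-z]≈xy-xz)
  open AbelianGroupProperties +-abelianGroup using (xyx⁻¹≈y)
  open SetoidReasoning setoid
  e∈ e∉ ⊇F ⊆F all : Carrier
  e∈  = sumProper (λ G → ⌊ e ∈? G ⌋) X
  e∉  = sumProper (λ G → not ⌊ e ∈? G ⌋) X
  ⊇F  = sumProper (λ G → ⌊ F ⊆? G ⌋) X
  ⊆F  = sumProper (λ G → ⌊ G ⊆? F ⌋) X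
  all = sumProper (λ _ → true) X
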